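{- For every integer $q\ge 2$, the graph $\overline{ME^*_q}$ has a frozen $(2q+1)$-clique-partition.
   Context: For $q\ge 2$, $\overline{ME_q}$ is the graph with the $4q+2$ vertices $u_0,u_1,\dots,u_{q+1}$ and $v_{i1},v_{i2},v_{i3}$ ($i=1,\dots,q$), whose edges are: the edges of the Hamiltonian cycle $u_0,u_1,\dots,u_{q+1},v_{11},v_{12},v_{13},v_{21},v_{22},v_{23},\dots,v_{q1},v_{q2},v_{q3},u_0$; the edges $u_iv_{i2}$ for $i=1,\dots,q$; and the edges $v_{i1}v_{i3}$ for $i=1,\dots,q$. $\overline{ME^*_q}$ is obtained from $\overline{ME_q}$ by adding the edge $u_0u_{q+1}$. A $k$-clique-partition is a partition of the vertex set into at most $k$ (ordered, possibly empty) cliques; it is frozen if every vertex $v$ has a non-neighbour in each of the $k$ cliques other than the one containing $v$. -}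

module Defs where

open import Data.Nat using (ℕ; zero; suc)
open import Data.Fin using (Fin; toℕ)
open import Data.Product using (Σ; _×_)
open import Data.Sum using (_⊎_)
open import Relation.Binary.PropositionalEquality using (_≡_; _≢_)
open import Relation.Nullary using (¬_)

-- Vertices of the graph ME_q-bar:
--   U i    is u_i               (i = 0 .. q+1)
--   V a b  is v_{(a+1)(b+1)}    (a : Fin q encodes i = a+1 ∈ 1..q, b : Fin 3 encodes j = b+1 ∈ 1..3)
data Vertex (q : ℕ) : Set where
  U : Fin (suc (suc q)) → Vertex q
  V : Fin q → Fin 3 → Vertex q

data EdgeME (q : ℕ) : Vertex q → Vertex q → Set where
  cyc-uu : (i j : Fin (suc (suc q))) → toℕ j ≡ suc (toℕ i) → EdgeME q (U i) (U j)
  -- Hamiltonian cycle: u_{q+1} v_{11}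
  cyc-uv : (i : Fin (suc (suc q))) (a : Fin q) (b : Fin 3) →
           toℕ i ≡ suc q → toℕ a ≡ 0 → toℕ b ≡ 0 → EdgeME q (U i) (V a b)
  -- Hamiltonian cycle: v_{i1} v_{i2} and v_{i2} v_{i3}
  cyc-in : (a : Fin q) (b c : Fin 3) → toℕ c ≡ suc (toℕ b) → EdgeME q (V a b) (V a c)
  -- Hamiltonian cycle: v_{i3} v_{(i+1)1}  (i = 1 .. q-1)
  cyc-vv : (a a′ : Fin q) (b c : Fin 3) →
           toℕ a′ ≡ suc (toℕ a) → toℕ b ≡ 2 → toℕ c ≡ 0 → EdgeME q (V a b) (V a′ c)
  -- Hamiltonian cycle: v_{q3} u_0
  cyc-vu : (a : Fin q) (b : Fin 3) (i : Fin (suc (suc q))) →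
           suc (toℕ a) ≡ q → toℕ b ≡ 2 → toℕ i ≡ 0 → EdgeME q (V a b) (U i)
  -- chords u_i v_{i2}  (i = 1 .. q)
  chord-uv : (i : Fin (suc (suc q))) (a : Fin q) (b : Fin 3) →
             toℕ i ≡ suc (toℕ a) → toℕ b ≡ 1 → EdgeME q (U i) (V a b)
  -- chords v_{i1} v_{i3}  (i = 1 .. q)
  chord-vv : (a : Fin q) (b c : Fin 3) → toℕ b ≡ 0 → toℕ c ≡ 2 → EdgeME q (V a b) (V a c)

AdjME : (q : ℕ) → Vertex q → Vertex q → Set
AdjME q x y = EdgeME q x y ⊎ EdgeME q y x

data EdgeME* (q : ℕ) : Vertex q → Vertex q → Set where
  old : ∀ {x y} → EdgeME q x y → EdgeME* q x y
  new : (i j : Fin (suc (suc q))) → toℕ i ≡ 0 → toℕ j ≡ suc q → EdgeME* q (U i) (U j)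

AdjME* : (q : ℕ) → Vertex q → Vertex q → Set
AdjME* q x y = EdgeME* q x y ⊎ EdgeME* q y x

-- A k-clique-partition of a graph with vertex type X and adjacency Adj:
-- an assignment of each vertex to one of k (ordered, possibly empty) classes,
-- each class being a clique.
IsCliquePartition : {X : Set} (Adj : X → X → Set) (k : ℕ) → (X → Fin k) → Set
IsCliquePartition {X} Adj k c = (x y : X) → c x ≡ c y → x ≢ y → Adj x y

IsFrozen : {X : Set} (Adj : X → X → Set) (k : ℕ) → (X → Fin k) → Set
IsFrozen {X} Adj k c =
  (v : X) (j : Fin k) → j ≢ c v → Σ X (λ w → c w ≡ j × w ≢ v × ¬ Adj v w)

HasFrozenCliquePartition : {X : Set} (Adj : X → X → Set) (k : ℕ) → Set
HasFrozenCliquePartition {X} Adj k =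
  Σ (X → Fin k) (λ c → IsCliquePartition Adj k c × IsFrozen Adj k c)

{-# OPTIONS --safe #-}
module Submission where

open import Defs
open import Data.Nat using (ℕ; suc; _+_; _*_; _≤_)
open import Data.Nat.Tactic.RingSolver using (solve-∀)
open import Data.Fin using (Fin; zero; suc; toℕ; fromℕ; inject₁)
open import Data.Fin.Patterns using (0F; 1F; 2F)
open import Data.Fin.Properties using (toℕ-injective; toℕ-fromℕ; toℕ-inject₁; +↔⊎)
import Data.Fin.Properties as Fin
open import Data.Fin.Relation.Unary.Top using (view; ‵fromℕ; ‵inject₁; view-fromℕ; view-inject₁)
open import Data.Maybe using (Maybe; just; nothing)
open import Data.Maybe.Properties using (just-injective; ≡-dec)
open import Data.Product using (Σ; _×_; _,_)
open import Data.Sum as Sum using (_⊎_; inj₁; inj₂; [_,_]′; swap)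
open import Function using (_∘_; _↔_; Inverse)
open import Relation.Binary using (Symmetric; DecidableEquality)
open import Relation.Binary.PropositionalEquality
open import Relation.Nullary using (¬_; yes; no; contradiction)

-- The partition is a perfect matching M of ME*_q: the q chords u_i v_{i2} and the q + 1
-- Hamiltonian-cycle edges u_{q+1} v_{11}, v_{i3} v_{(i+1)1}, v_{q3} u_0.  Deleting M leaves
-- the cycle u_0 … u_{q+1} u_0 and the q triangles v_{i1} v_{i2} v_{i3}, and every edge of M
-- joins two different components.  Hence outside its own class a vertex v is
-- adjacent only to vertices of its own component, whereas every other class has an
-- endpoint outside that component: a non-neighbour of v.

record PerfectMatching {X : Set} (Adj : X → X → Set) (C : Set) : Set where
  field
    class         : X → C
    left right    : C → X
    class-left    : ∀ j → class (left j) ≡ j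
    class-right   : ∀ j → class (right j) ≡ j
    left-or-right : ∀ x → x ≡ left (class x) ⊎ x ≡ right (class x)
    matched       : ∀ j → Adj (left j) (right j)

-- A labelling of the vertices, e.g. by the components of G − M, that every matching edge
-- crosses and no other edge crosses.
record Separating {X C : Set} {Adj : X → X → Set} (M : PerfectMatching Adj C) (K : Set) : Set where
  open PerfectMatching M
  field
    component : X → K
    across    : ∀ j → component (left j) ≢ component (right j)
    within    : ∀ {v w} → Adj v w → class v ≡ class w ⊎ component v ≡ component w

module _ {X C K : Set} {Adj : X → X → Set} (M : PerfectMatching Adj C) where
  open PerfectMatching M

  member : ∀ {x j} → class x ≡ j → x ≡ left j ⊎ x ≡ right j
  member {x} refl = left-or-right x

  same-class⇒adjacent : Symmetric Adj → ∀ {j x y} → class x ≡ j → class y ≡ j → x ≢ y → Adj x y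
  same-class⇒adjacent Adj-sym x∈j y∈j x≢y with member x∈j | member y∈j
  ... | inj₁ refl | inj₁ refl = contradiction refl x≢y
  ... | inj₁ refl | inj₂ refl = matched _
  ... | inj₂ refl | inj₁ refl = Adj-sym (matched _)
  ... | inj₂ refl | inj₂ refl = contradiction refl x≢y

  module _ (S : Separating M K) (_≟_ : DecidableEquality K) where
    open Separating S

    outside : ∀ {v w j} → class w ≡ j → class v ≢ j → component v ≢ component w →
              w ≢ v × ¬ Adj v w
    outside refl v∉j v≁w = (λ { refl → v∉j refl }) , [ v∉j , v≁w ]′ ∘ within

    non-neighbour : ∀ v j → class v ≢ j → Σ X λ w → class w ≡ j × w ≢ v × ¬ Adj v w
    non-neighbour v j v∉j with component v ≟ component (left j)
    ... | no  v≁l = left j , class-left j , outside (class-left j) v∉j v≁l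
    ... | yes v∼l = right j , class-right j ,
                    outside (class-right j) v∉j (λ v∼r → across j (trans (sym v∼l) v∼r))

    frozenCliquePartition : ∀ {k} → Fin k ↔ C → Symmetric Adj → HasFrozenCliquePartition Adj k
    frozenCliquePartition code Adj-sym = colour , clique , frozen
      where
      open Inverse code using (to; from; strictlyInverseˡ; strictlyInverseʳ)

      colour : X → Fin _
      colour = from ∘ class

      from-injective : ∀ {a b} → from a ≡ from b → a ≡ b
      from-injective {a} {b} eq = trans (sym (strictlyInverseˡ a)) (trans (cong to eq) (strictlyInverseˡ b))

      clique : IsCliquePartition Adj _ colour
      clique x y cx≡cy = same-class⇒adjacent Adj-sym refl (sym (from-injective cx≡cy))

      frozen : IsFrozen Adj _ colour
      frozen v i i≢cv with non-neighbour v (to i) (λ v∈i → i≢cv (trans (sym (strictlyInverseʳ i)) (cong from (sym v∈i))))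
      ... | w , w∈i , w≢v , v≁w = w , trans (cong from w∈i) (strictlyInverseʳ i) , w≢v , v≁w

inject₁≢suc : ∀ {n} (a : Fin n) → inject₁ a ≢ suc a
inject₁≢suc (suc a) eq = inject₁≢suc a (Fin.suc-injective eq)

pattern chord a = inj₁ a
pattern link t  = inj₂ t

-- Classes: chord a = {u_{a+1}, v_{(a+1)2}}; link t joins the last vertex of block t − 1 to
-- the first vertex of block t, where the blocks along the Hamiltonian cycle are the
-- triangles 0 … q − 1 and the path u_0 … u_{q+1}, counted both as block −1 and as block q.
module MEStar (p : ℕ) where
  q : ℕ
  q = suc p

  Class : Set
  Class = Fin q ⊎ Fin (suc q)

  left : Class → Vertex q
  left (chord a)      = U (suc (inject₁ a))
  left (link zero)    = U (fromℕ (suc q))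
  left (link (suc a)) = V a 2F

  right : Class → Vertex q
  right (chord a) = V a 1F
  right (link t) with view t
  ... | ‵fromℕ     = U zero
  ... | ‵inject₁ a = V a 0F

  class : Vertex q → Class
  class (U zero) = link (fromℕ q)
  class (U (suc i)) with view i
  ... | ‵fromℕ     = link zero
  ... | ‵inject₁ a = chord a
  class (V a 0F) = link (inject₁ a)
  class (V a 1F) = chord a
  class (V a 2F) = link (suc a)

  class-U-last : class (U (fromℕ (suc q))) ≡ link zero
  class-U-last rewrite view-fromℕ q = refl

  class-U-inner : ∀ a → class (U (suc (inject₁ a))) ≡ chord a
  class-U-inner a rewrite view-inject₁ a = refl

  class-left : ∀ j → class (left j) ≡ j
  class-left (chord a)      = class-U-inner a
  class-left (link zero)    = class-U-last
  class-left (link (suc a)) = refl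

  class-right : ∀ j → class (right j) ≡ j
  class-right (chord a) = refl
  class-right (link t) with view t
  ... | ‵fromℕ     = refl
  ... | ‵inject₁ a = refl

  left-or-right : ∀ x → x ≡ left (class x) ⊎ x ≡ right (class x)
  left-or-right (U zero) rewrite view-fromℕ q = inj₂ refl
  left-or-right (U (suc i)) with view i
  ... | ‵fromℕ     = inj₁ refl
  ... | ‵inject₁ a = inj₁ refl
  left-or-right (V a 0F) rewrite view-inject₁ a = inj₂ refl
  left-or-right (V a 1F) = inj₂ refl
  left-or-right (V a 2F) = inj₁ refl

  edge : ∀ {x y} → EdgeME q x y → AdjME* q x y
  edge = inj₁ ∘ old

  matched : ∀ j → AdjME* q (left j) (right j)
  matched (chord a) = edge (chord-uv (suc (inject₁ a)) a 1F (cong suc (toℕ-inject₁ a)) refl)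
  matched (link t) with view t
  ... | ‵fromℕ           = edge (cyc-vu (fromℕ p) 2F zero (cong suc (toℕ-fromℕ p)) refl refl)
  ... | ‵inject₁ zero    = edge (cyc-uv (fromℕ (suc q)) zero 0F (toℕ-fromℕ (suc q)) refl refl)
  ... | ‵inject₁ (suc a) = edge (cyc-vv (inject₁ a) (suc a) 2F 0F (cong suc (sym (toℕ-inject₁ a))) refl refl)

  matching : PerfectMatching (AdjME* q) Class
  matching = record
    { class = class ; left = left ; right = right
    ; class-left = class-left ; class-right = class-right
    ; left-or-right = left-or-right ; matched = matched
    }

  component : Vertex q → Maybe (Fin q)
  component (U _)   = nothing
  component (V a _) = just a

  across : ∀ j → component (left j) ≢ component (right j)
  across (chord a) ()
  across (link t) with view t
  ... | ‵fromℕ           = λ ()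
  ... | ‵inject₁ zero    = λ ()
  ... | ‵inject₁ (suc a) = inject₁≢suc a ∘ just-injective

  open ≡-Reasoning

  edge-within : ∀ {v w} → EdgeME* q v w → class v ≡ class w ⊎ component v ≡ component w
  edge-within (new _ _ _ _)                 = inj₂ refl
  edge-within (old (cyc-uu _ _ _))          = inj₂ refl
  edge-within (old (cyc-in _ _ _ _))        = inj₂ refl
  edge-within (old (chord-vv _ _ _ _ _))    = inj₂ refl
  edge-within (old (cyc-uv i zero 0F i≡q+1 _ _)) = inj₁ (begin
    class (U i)                ≡⟨ cong (class ∘ U) (toℕ-injective (trans i≡q+1 (sym (toℕ-fromℕ (suc q))))) ⟩
    class (U (fromℕ (suc q)))  ≡⟨ class-U-last ⟩
    link zero                  ∎)
  edge-within (old (cyc-uv _ (suc _) _ _ () _))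
  edge-within (old (cyc-uv _ _ (suc _) _ _ ()))
  edge-within (old (cyc-vv a a′ 2F 0F a′≡1+a _ _)) =
    inj₁ (cong link (toℕ-injective (sym (trans (toℕ-inject₁ a′) a′≡1+a))))
  edge-within (old (cyc-vv _ _ 0F _ _ () _))
  edge-within (old (cyc-vv _ _ 1F _ _ () _))
  edge-within (old (cyc-vv _ _ 2F (suc _) _ _ ()))
  edge-within (old (cyc-vu a 2F zero 1+a≡q _ _)) =
    inj₁ (cong link (toℕ-injective (trans 1+a≡q (sym (toℕ-fromℕ q)))))
  edge-within (old (cyc-vu _ 0F _ _ () _))
  edge-within (old (cyc-vu _ 1F _ _ () _))
  edge-within (old (cyc-vu _ 2F (suc _) _ _ ()))
  edge-within (old (chord-uv i a 1F i≡1+a _)) = inj₁ (begin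
    class (U i)                  ≡⟨ cong (class ∘ U) (toℕ-injective (trans i≡1+a (cong suc (sym (toℕ-inject₁ a))))) ⟩
    class (U (suc (inject₁ a)))  ≡⟨ class-U-inner a ⟩
    chord a                      ∎)
  edge-within (old (chord-uv _ _ 0F _ ()))
  edge-within (old (chord-uv _ _ 2F _ ()))

  separating : Separating matching (Maybe (Fin q))
  separating = record
    { component = component
    ; across    = across
    ; within    = λ { (inj₁ e) → edge-within e ; (inj₂ e) → Sum.map sym sym (edge-within e) }
    }

n+suc-n≡2n+1 : ∀ n → n + suc n ≡ 2 * n + 1
n+suc-n≡2n+1 = solve-∀

-- The construction only needs q ≥ 1.
theorem8 : (q : ℕ) → 2 ≤ q → HasFrozenCliquePartition (AdjME* q) (2 * q + 1)
theorem8 0 ()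
theorem8 (suc p) _ =
  subst (HasFrozenCliquePartition (AdjME* (suc p))) (n+suc-n≡2n+1 (suc p))
    (frozenCliquePartition matching separating (≡-dec Fin._≟_) +↔⊎ swap)
  where open MEStar p
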